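{- For every $m\in\mathbb N$, there is a deterministic $2$-competitive online algorithm for Online Makespan Scheduling under Scenarios with $m$ machines and $K=3$ scenarios, restricted to instances with unit processing times $p_j=1$ for all jobs $j$.
   Context: Online Makespan Scheduling under Scenarios with $m$ machines and $K$ scenarios (both known in advance): an instance consists of $n$ jobs with processing times $p_j\ge0$ and scenarios $S_1,\dots,S_K\subseteq[n]$ (not known in advance); jobs are revealed in order $1,\dots,n$, and on revelation of job $j$ the algorithm learns $p_j$ and which scenarios contain $j$, and must irrevocably assign $j$ to a machine $\tau(j)\in[m]$. With $J_i=\tau^{ -1}(i)$ and $p(S)=\sum_{j\in S}p_j$, the makespan is $\max_{k}\max_i p(J_i\cap S_k)$; an algorithm is $\rho$-competitive if its makespan is always at most $\rho$ times the offline optimum (minimum makespan over all partitions of $[n]$ into $m$ machines). -}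

module Defs where

open import Data.Nat using (ℕ; zero; suc; _+_; _⊔_)
open import Data.Bool using (Bool; true; false; _∧_; if_then_else_)
open import Data.Fin using (Fin; _≟_)
open import Data.Fin.Subset using (Subset)
open import Data.List using (List; []; _∷_; _++_; [_])
import Data.List as List
open import Data.Vec using (Vec; []; _∷_; replicate; lookup)
open import Relation.Nullary.Decidable using (⌊_⌋)

K : ℕ
K = 3

-- What the algorithm learns about a job when it is revealed (besides p_j,
-- which is 1 for all jobs in the unit-time setting): the set of scenarios
-- containing it, as a subset of Fin K.
JobInfo : Set
JobInfo = Subset K

-- A deterministic online algorithm for m machines: given the history of
-- previously revealed jobs (oldest first) and the newly revealed job, it
-- irrevocably chooses a machine.  (Its own earlier decisions are a function
-- of the history, so they need not be passed explicitly.)  It does not know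
-- n or the future jobs.
OnlineAlg : ℕ → Set
OnlineAlg m = List JobInfo → JobInfo → Fin m

runAlg : ∀ {m n} → OnlineAlg m → List JobInfo → Vec JobInfo n → Vec (Fin m) n
runAlg alg hist []       = []
runAlg alg hist (x ∷ xs) = alg hist x ∷ runAlg alg (hist ++ [ x ]) xs

-- (job with info x lies in scenario k iff lookup x k = true, i.e. k ∈ x)
-- p(J_i ∩ S_k) for processing times p, scenario data xs, assignment τ.
load : ∀ {m n} → Vec ℕ n → Vec JobInfo n → Vec (Fin m) n → Fin m → Fin K → ℕ
load []       []       []       i k = 0
load (p ∷ ps) (x ∷ xs) (t ∷ ts) i k =
  (if ⌊ t ≟ i ⌋ ∧ lookup x k then p else 0) + load ps xs ts i k

maxFin : ∀ {n} → (Fin n → ℕ) → ℕ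
maxFin {n} f = List.foldr _⊔_ 0 (List.map f (List.allFin n))

makespan : ∀ {m n} → Vec ℕ n → Vec JobInfo n → Vec (Fin m) n → ℕ
makespan {m} ps xs τ = maxFin (λ k → maxFin (λ i → load {m} ps xs τ i k))

units : (n : ℕ) → Vec ℕ n
units n = replicate n 1

-- The algorithm is greedy: a job goes to a machine minimising the sum of that machine's
-- loads over the scenarios containing the job. If B is the optimal makespan, each scenario
-- has at most m B jobs, so by averaging over the machines the chosen machine's loads in the
-- t scenarios of the job sum to less than t B. This preserves, on every machine with loads
-- a_k and total T, the invariant a_k ≤ 2 B and 2 a_k ≤ T + B: a job in t ≤ 2 scenarios is
-- placed where each of its loads is below t B ≤ 2 B (and t = 1 gives a_k < B), and a job in
-- all three scenarios is placed where T < 3 B, whence 2 a_k ≤ T + B < 4 B.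

module Submission where

open import Defs
open import Data.Bool using (Bool; true; false; _∧_; if_then_else_)
open import Data.Empty using (⊥-elim)
open import Data.Fin using (Fin; zero; suc; _≟_)
open import Data.Fin.Subset using (Subset; ⊤; ∣_∣)
open import Data.Fin.Subset.Properties using (∣p∣≤n; ∣p∣≡n⇒p≡⊤)
open import Data.List using (List; []; _∷_; _++_; [_]; foldl; foldr; allFin)
open import Data.List.Extrema.Nat using (argmin; f[argmin]≤f[xs])
open import Data.List.Membership.Propositional using (_∈_)
open import Data.List.Membership.Propositional.Properties using (∈-allFin; ∈-map⁺)
open import Data.List.Properties using (foldl-++; ++-assoc; ++-identityʳ)
open import Data.List.Relation.Unary.All as All using (All; []; _∷_)
open import Data.List.Relation.Unary.All.Properties using (map⁺; tabulate⁺)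
open import Data.List.Relation.Unary.Any using (here; there)
open import Data.Nat using (ℕ; zero; suc; _+_; _*_; _≤_; _<_; _⊔_; z≤n; s≤s)
open import Data.Nat.Properties
  using ( +-0-commutativeMonoid; module ≤-Reasoning
        ; ≤-trans; ≤-<-trans; <-≤-trans; <⇒≤; ≤-pred; n≮0; m≤n⇒m<n∨m≡n
        ; m≤m+n; m≤n+m; m<m+n; m≤m⊔n; m≤n⊔m; ⊔-lub
        ; +-identityʳ; +-mono-≤; +-mono-<-≤; +-mono-≤-<; +-monoˡ-≤; +-monoʳ-≤; +-monoˡ-<
        ; *-identityˡ; *-identityʳ; *-zeroʳ; *-suc; *-monoˡ-≤; *-cancelˡ-<
        )
open import Data.Nat.Tactic.RingSolver using (solve-∀)
open import Data.Product using (Σ; _,_)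
open import Data.Sum as Sum using (_⊎_; inj₁; inj₂)
open import Data.Vec using (Vec; []; _∷_; lookup; toList)
open import Data.Vec.Properties using (lookup-replicate)
open import Function using (_∘_)
open import Relation.Binary.PropositionalEquality
  using (_≡_; refl; sym; trans; cong; cong₂; subst; module ≡-Reasoning)
open import Relation.Nullary.Decidable using (⌊_⌋; ⌊⌋-map′; yes; no)
open import Algebra.Properties.CommutativeMonoid.Sum +-0-commutativeMonoid
  using (sum; ∑-distrib-+; ∑-comm; sum-cong-≗)

private variable
  m n B c : ℕ

indicator : Bool → ℕ
indicator b = if b then 1 else 0

sum-mono-≤ : {f g : Fin n → ℕ} → (∀ i → f i ≤ g i) → sum f ≤ sum g
sum-mono-≤ {zero}  f≤g = z≤n
sum-mono-≤ {suc n} f≤g = +-mono-≤ (f≤g zero) (sum-mono-≤ (f≤g ∘ suc))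

sum-mono-< : {f g : Fin n → ℕ} → (∀ i → f i ≤ g i) → ∀ j → f j < g j →
             sum f < sum g
sum-mono-< f≤g zero    fj<gj = +-mono-<-≤ fj<gj (sum-mono-≤ (f≤g ∘ suc))
sum-mono-< f≤g (suc j) fj<gj = +-mono-≤-< (f≤g zero) (sum-mono-< (f≤g ∘ suc) j fj<gj)

f≤sum : ∀ (f : Fin n → ℕ) i → f i ≤ sum f
f≤sum f zero    = m≤m+n (f zero) _
f≤sum f (suc i) = ≤-trans (f≤sum (f ∘ suc) i) (m≤n+m _ (f zero))

sum-const : ∀ n c → sum {n} (λ _ → c) ≡ n * c
sum-const zero    c = refl
sum-const (suc n) c = cong (c +_) (sum-const n c)

sum-zero : ∀ n → sum {n} (λ _ → 0) ≡ 0
sum-zero n = trans (sum-const n 0) (*-zeroʳ n)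

*≤sum : {f : Fin n → ℕ} → (∀ i → c ≤ f i) → n * c ≤ sum f
*≤sum {n} {c} c≤f = subst (_≤ _) (sum-const n c) (sum-mono-≤ c≤f)

sum≤* : {f : Fin n → ℕ} → (∀ i → f i ≤ c) → sum f ≤ n * c
sum≤* {n} {c} f≤c = subst (_ ≤_) (sum-const n c) (sum-mono-≤ f≤c)

sum-indicator-≟ : ∀ (c : Fin n) b →
                  sum (λ i → indicator (⌊ c ≟ i ⌋ ∧ b)) ≡ indicator b
sum-indicator-≟ {suc n} zero    b = trans (cong (indicator b +_) (sum-zero n)) (+-identityʳ _)
sum-indicator-≟ {suc n} (suc c) b =
  trans (sum-cong-≗ (λ i → cong (λ d → indicator (d ∧ b)) (⌊⌋-map′ _ _ (c ≟ i))))
        (sum-indicator-≟ c b)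

foldr-⊔-lub : {xs : List ℕ} → All (_≤ c) xs → foldr _⊔_ 0 xs ≤ c
foldr-⊔-lub []          = z≤n
foldr-⊔-lub (x≤c ∷ xs≤c) = ⊔-lub x≤c (foldr-⊔-lub xs≤c)

∈⇒≤foldr-⊔ : {x : ℕ} {xs : List ℕ} → x ∈ xs → x ≤ foldr _⊔_ 0 xs
∈⇒≤foldr-⊔ (here refl) = m≤m⊔n _ _
∈⇒≤foldr-⊔ (there x∈xs) = ≤-trans (∈⇒≤foldr-⊔ x∈xs) (m≤n⊔m _ _)

maxFin-lub : {f : Fin n → ℕ} → (∀ i → f i ≤ c) → maxFin f ≤ c
maxFin-lub f≤c = foldr-⊔-lub (map⁺ (tabulate⁺ f≤c))

f≤maxFin : ∀ (f : Fin n → ℕ) i → f i ≤ maxFin f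
f≤maxFin f i = ∈⇒≤foldr-⊔ (∈-map⁺ f (∈-allFin i))

sumOver : Subset n → (Fin n → ℕ) → ℕ
sumOver x a = sum (λ k → if lookup x k then a k else 0)

sumOver-⊤ : ∀ (a : Fin n → ℕ) → sumOver ⊤ a ≡ sum a
sumOver-⊤ a = sum-cong-≗ (λ k → cong (if_then a k else 0) (lookup-replicate k true))

sumOver-const : ∀ (x : Subset n) c → sumOver x (λ _ → c) ≡ ∣ x ∣ * c
sumOver-const []          c = refl
sumOver-const (true ∷ x)  c = cong (c +_) (sumOver-const x c)
sumOver-const (false ∷ x) c = sumOver-const x c

∈⇒≤sumOver : ∀ (x : Subset n) a {k} → lookup x k ≡ true → a k ≤ sumOver x a
∈⇒≤sumOver x a {k} k∈x =
  subst (λ b → (if b then a k else 0) ≤ sumOver x a) k∈x (f≤sum _ k)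

sumOver-< : ∀ (x : Subset n) {a b : Fin n → ℕ} →
            (∀ k → lookup x k ≡ true → a k < b k) →
            ∀ {k} → lookup x k ≡ true → sumOver x a < sumOver x b
sumOver-< x {a} {b} a<b {k} k∈x = sum-mono-< pointwise k
  (subst (λ β → (if β then a k else 0) < (if β then b k else 0)) (sym k∈x) (a<b k k∈x))
  where
  pointwise : ∀ j → (if lookup x j then a j else 0) ≤ (if lookup x j then b j else 0)
  pointwise j with lookup x j in j∈x
  ... | true  = <⇒≤ (a<b j j∈x)
  ... | false = z≤n

sum-if : ∀ b (f : Fin m → ℕ) →
         sum (λ i → if b then f i else 0) ≡ (if b then sum f else 0)
sum-if     true  f = refl
sum-if {m} false f = sum-zero m

sum-sumOver : ∀ (x : Subset n) (s : Fin m → Fin n → ℕ) →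
              sum (λ i → sumOver x (s i)) ≡ sumOver x (λ k → sum (λ i → s i k))
sum-sumOver x s =
  trans (∑-comm (λ i k → if lookup x k then s i k else 0))
        (sum-cong-≗ (λ k → sum-if (lookup x k) (λ i → s i k)))

∣x∣<n⊎x≡⊤ : ∀ (x : Subset n) → ∣ x ∣ < n ⊎ x ≡ ⊤
∣x∣<n⊎x≡⊤ x = Sum.map₂ ∣p∣≡n⇒p≡⊤ (m≤n⇒m<n∨m≡n (∣p∣≤n x))

addJob : Subset n → (Fin n → ℕ) → Fin n → ℕ
addJob x a k = indicator (lookup x k) + a k

sum-addJob : ∀ (x : Subset n) a → sum (addJob x a) ≡ ∣ x ∣ + sum a
sum-addJob x a =
  trans (∑-distrib-+ (indicator ∘ lookup x) a)
        (cong (_+ sum a) (trans (sumOver-const x 1) (*-identityʳ ∣ x ∣)))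

record Balanced (B : ℕ) (a : Fin n → ℕ) : Set where
  field
    bounded   : ∀ k → a k ≤ 2 * B
    dominated : ∀ k → 2 * a k ≤ sum a + B
open Balanced

Fits : ℕ → Subset n → (Fin n → ℕ) → Set
Fits B x a = ∀ {k} → lookup x k ≡ true → sumOver x a < ∣ x ∣ * B

-- The only use of K = 3: a job that misses some scenario lies in at most two of them.
member-bounded : ∀ {x : Subset K} {a k} → Balanced B a → lookup x k ≡ true →
                 sumOver x a < ∣ x ∣ * B → a k < 2 * B
member-bounded {B} {x} {a} {k} bal k∈x fits with ∣x∣<n⊎x≡⊤ x
... | inj₁ ∣x∣<3 = begin-strict
  a k          ≤⟨ ∈⇒≤sumOver x a k∈x ⟩
  sumOver x a  <⟨ fits ⟩
  ∣ x ∣ * B    ≤⟨ *-monoˡ-≤ B (≤-pred ∣x∣<3) ⟩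
  2 * B        ∎
  where open ≤-Reasoning
... | inj₂ refl = *-cancelˡ-< 2 (a k) (2 * B) (begin-strict
  2 * a k          ≤⟨ dominated bal k ⟩
  sum a + B        ≡⟨ cong (_+ B) (sumOver-⊤ a) ⟨
  sumOver ⊤ a + B  <⟨ +-monoˡ-< B fits ⟩
  3 * B + B        ≡⟨ 3B+B≡2[2B] B ⟩
  2 * (2 * B)      ∎)
  where
  open ≤-Reasoning
  3B+B≡2[2B] : ∀ B → 3 * B + B ≡ 2 * (2 * B)
  3B+B≡2[2B] = solve-∀

member-dominated : ∀ {x : Subset n} {a k} → Balanced B a → lookup x k ≡ true →
                   sumOver x a < ∣ x ∣ * B → 2 * suc (a k) ≤ ∣ x ∣ + sum a + B
member-dominated {B = B} {x} {a} {k} bal k∈x fits with ∣ x ∣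
... | zero = ⊥-elim (n≮0 fits)
... | suc zero = begin
  2 * suc (a k)          ≡⟨ cong (suc (a k) +_) (+-identityʳ (suc (a k))) ⟩
  suc (a k) + suc (a k)  ≤⟨ +-mono-≤ (s≤s (f≤sum a k)) ak<B ⟩
  suc (sum a) + B        ∎
  where
  open ≤-Reasoning
  ak<B : a k < B
  ak<B = ≤-<-trans (∈⇒≤sumOver x a k∈x) (subst (sumOver x a <_) (*-identityˡ B) fits)
... | suc (suc s) = begin
  2 * suc (a k)                ≡⟨ *-suc 2 (a k) ⟩
  2 + 2 * a k                  ≤⟨ +-monoʳ-≤ 2 (dominated bal k) ⟩
  2 + (sum a + B)              ≤⟨ +-monoʳ-≤ 2 (+-monoˡ-≤ B (m≤n+m (sum a) s)) ⟩
  suc (suc s) + sum a + B      ∎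
  where open ≤-Reasoning

balanced-addJob : ∀ {x : Subset K} {a} → Balanced B a → Fits B x a → Balanced B (addJob x a)
bounded (balanced-addJob {x = x} bal fits) k with lookup x k in k∈x
... | true  = member-bounded {x = x} bal k∈x (fits k∈x)
... | false = bounded bal k
dominated (balanced-addJob {B} {x} {a} bal fits) k
  rewrite sum-addJob x a with lookup x k in k∈x
... | true  = member-dominated {x = x} bal k∈x (fits k∈x)
... | false = ≤-trans (dominated bal k) (+-monoˡ-≤ B (m≤n+m (sum a) ∣ x ∣))

Loads : ℕ → Set
Loads m = Fin m → Fin K → ℕ

scenarioTotal : Loads m → Fin K → ℕ
scenarioTotal s k = sum (λ i → s i k)

place : Loads m → JobInfo → Fin m → Loads m
place s x c i = if ⌊ c ≟ i ⌋ then addJob x (s i) else s i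

place≡ : ∀ (s : Loads m) x c i k →
         place s x c i k ≡ indicator (⌊ c ≟ i ⌋ ∧ lookup x k) + s i k
place≡ s x c i k with ⌊ c ≟ i ⌋
... | true  = refl
... | false = refl

scenarioTotal-place : ∀ (s : Loads m) x c k →
                      scenarioTotal (place s x c) k ≡ indicator (lookup x k) + scenarioTotal s k
scenarioTotal-place s x c k =
  trans (sum-cong-≗ (λ i → place≡ s x c i k))
  (trans (∑-distrib-+ (λ i → indicator (⌊ c ≟ i ⌋ ∧ lookup x k)) (λ i → s i k))
         (cong (_+ scenarioTotal s k) (sum-indicator-≟ c (lookup x k))))

balanced-place : ∀ {s : Loads m} {x} c → (∀ i → Balanced B (s i)) →
                 Balanced B (addJob x (s c)) → ∀ i → Balanced B (place s x c i)
balanced-place c bal bal-c i with c ≟ i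
... | yes refl = bal-c
... | no  _    = bal i

greedy : Loads (suc m) → JobInfo → Fin (suc m)
greedy s x = argmin (λ i → sumOver x (s i)) zero (allFin _)

greedy-minimal : ∀ (s : Loads (suc m)) x i → sumOver x (s (greedy s x)) ≤ sumOver x (s i)
greedy-minimal s x i =
  All.lookup (f[argmin]≤f[xs] {f = λ j → sumOver x (s j)} zero (allFin _)) (∈-allFin i)

greedy-fits : ∀ (s : Loads (suc m)) x →
              (∀ k → lookup x k ≡ true → scenarioTotal s k < suc m * B) →
              Fits B x (s (greedy s x))
greedy-fits {m} {B} s x room k∈x = *-cancelˡ-< (suc m) _ _ (begin-strict
  suc m * sumOver x (s (greedy s x))      ≤⟨ *≤sum (greedy-minimal s x) ⟩
  sum (λ i → sumOver x (s i))             ≡⟨ sum-sumOver x s ⟩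
  sumOver x (scenarioTotal s)             <⟨ sumOver-< x room k∈x ⟩
  sumOver x (λ _ → suc m * B)             ≡⟨ sumOver-const x (suc m * B) ⟩
  ∣ x ∣ * (suc m * B)                     ≡⟨ *-comm-middle ∣ x ∣ (suc m) B ⟩
  suc m * (∣ x ∣ * B)                     ∎)
  where
  open ≤-Reasoning
  *-comm-middle : ∀ a b c → a * (b * c) ≡ b * (a * c)
  *-comm-middle = solve-∀

scenarioCount : List JobInfo → Fin K → ℕ
scenarioCount []      k = 0
scenarioCount (x ∷ h) k = indicator (lookup x k) + scenarioCount h k

sum-load : ∀ (xs : Vec JobInfo n) (τ : Vec (Fin m) n) k →
           sum (λ i → load (units n) xs τ i k) ≡ scenarioCount (toList xs) k
sum-load {m = m} []       []      k = sum-zero m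
sum-load         (x ∷ xs) (t ∷ τ) k =
  trans (∑-distrib-+ (λ i → indicator (⌊ t ≟ i ⌋ ∧ lookup x k))
                     (λ i → load (units _) xs τ i k))
        (cong₂ _+_ (sum-indicator-≟ t (lookup x k)) (sum-load xs τ k))

load≤makespan : ∀ (ps : Vec ℕ n) xs (τ : Vec (Fin m) n) i k →
                load ps xs τ i k ≤ makespan ps xs τ
load≤makespan ps xs τ i k = ≤-trans (f≤maxFin (λ i → load ps xs τ i k) i)
                                    (f≤maxFin (λ k → maxFin (λ i → load ps xs τ i k)) k)

makespan-lub : ∀ {ps : Vec ℕ n} {xs} {τ : Vec (Fin m) n} →
               (∀ i k → load ps xs τ i k ≤ c) → makespan ps xs τ ≤ c
makespan-lub load≤c = maxFin-lub (λ k → maxFin-lub (λ i → load≤c i k))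

scenarioCount≤ : ∀ (xs : Vec JobInfo n) (σ : Vec (Fin m) n) k →
                 scenarioCount (toList xs) k ≤ m * makespan (units n) xs σ
scenarioCount≤ {n} xs σ k =
  subst (_≤ _) (sum-load xs σ k) (sum≤* (λ i → load≤makespan (units n) xs σ i k))

balanced-zero : Balanced {n} B (λ _ → 0)
balanced-zero = record { bounded = λ _ → z≤n ; dominated = λ _ → z≤n }

module Greedy (m : ℕ) where

  step : Loads (suc m) → JobInfo → Loads (suc m)
  step s x = place s x (greedy s x)

  noLoads : Loads (suc m)
  noLoads _ _ = 0

  loads : List JobInfo → Loads (suc m)
  loads = foldl step noLoads

  greedyAlg : OnlineAlg (suc m)
  greedyAlg h = greedy (loads h)

  balanced-foldl : ∀ s h → (∀ i → Balanced B (s i)) →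
                   (∀ k → scenarioTotal s k + scenarioCount h k ≤ suc m * B) →
                   ∀ i → Balanced B (foldl step s h i)
  balanced-foldl s []      bal room = bal
  balanced-foldl {B} s (x ∷ h) bal room = balanced-foldl (step s x) h bal′ room′
    where
    chosen = greedy s x

    room-x : ∀ k → lookup x k ≡ true → scenarioTotal s k < suc m * B
    room-x k k∈x = <-≤-trans (m<m+n _ (s≤s z≤n))
      (subst (λ b → scenarioTotal s k + (indicator b + scenarioCount h k) ≤ suc m * B)
             k∈x (room k))

    bal′ : ∀ i → Balanced B (step s x i)
    bal′ = balanced-place {s = s} {x = x} chosen bal
             (balanced-addJob {x = x} (bal chosen) (greedy-fits s x room-x))

    room′ : ∀ k → scenarioTotal (step s x) k + scenarioCount h k ≤ suc m * B
    room′ k = begin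
      scenarioTotal (step s x) k + rest  ≡⟨ cong (_+ rest) (scenarioTotal-place s x chosen k) ⟩
      δ + scenarioTotal s k + rest       ≡⟨ swap-front δ (scenarioTotal s k) rest ⟩
      scenarioTotal s k + (δ + rest)     ≤⟨ room k ⟩
      suc m * B                          ∎
      where
      open ≤-Reasoning
      δ = indicator (lookup x k)
      rest = scenarioCount h k
      swap-front : ∀ a b d → a + b + d ≡ b + (a + d)
      swap-front = solve-∀

  balanced-loads : ∀ h → (∀ k → scenarioCount h k ≤ suc m * B) →
                   ∀ i → Balanced B (loads h i)
  balanced-loads {B} h room = balanced-foldl noLoads h (λ _ → balanced-zero) room₀
    where
    room₀ : ∀ k → scenarioTotal noLoads k + scenarioCount h k ≤ suc m * B
    room₀ k = subst (λ t → t + scenarioCount h k ≤ suc m * B) (sym (sum-zero (suc m)))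
                    (room k)

  loads-snoc : ∀ h x → loads (h ++ [ x ]) ≡ step (loads h) x
  loads-snoc h x = foldl-++ step _ h [ x ]

  loads-runAlg : ∀ h (xs : Vec JobInfo n) i k →
                 loads h i k + load (units n) xs (runAlg greedyAlg h xs) i k
                   ≡ loads (h ++ toList xs) i k
  loads-runAlg h []       i k =
    trans (+-identityʳ _) (cong (λ h′ → loads h′ i k) (sym (++-identityʳ h)))
  loads-runAlg h (x ∷ xs) i k = begin
    ℓ + (δ + L)                            ≡⟨ rearrange ℓ δ L ⟩
    (δ + ℓ) + L                            ≡⟨ cong (_+ L) (place≡ (loads h) x (greedyAlg h x) i k) ⟨
    step (loads h) x i k + L               ≡⟨ cong (λ s → s i k + L) (loads-snoc h x) ⟨
    loads (h ++ [ x ]) i k + L             ≡⟨ loads-runAlg (h ++ [ x ]) xs i k ⟩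
    loads ((h ++ [ x ]) ++ toList xs) i k  ≡⟨ cong (λ h′ → loads h′ i k) (++-assoc h [ x ] _) ⟩
    loads (h ++ x ∷ toList xs) i k         ∎
    where
    open ≡-Reasoning
    ℓ = loads h i k
    δ = indicator (⌊ greedyAlg h x ≟ i ⌋ ∧ lookup x k)
    L = load (units _) xs (runAlg greedyAlg (h ++ [ x ]) xs) i k
    rearrange : ∀ a b d → a + (b + d) ≡ b + a + d
    rearrange = solve-∀

mainTheorem14 : (m : ℕ) → 1 ≤ m →
    Σ (OnlineAlg m) λ alg →
      (n : ℕ) (xs : Vec JobInfo n) (σ : Vec (Fin m) n) →
        makespan (units n) xs (runAlg alg [] xs) ≤ 2 * makespan (units n) xs σ
mainTheorem14 zero    ()
mainTheorem14 (suc m) _  = greedyAlg , competitive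
  where
  open Greedy m
  competitive : ∀ n (xs : Vec JobInfo n) σ →
                makespan (units n) xs (runAlg greedyAlg [] xs) ≤ 2 * makespan (units n) xs σ
  competitive n xs σ = makespan-lub {ps = units n} {xs} λ i k → begin
    load (units n) xs (runAlg greedyAlg [] xs) i k  ≡⟨ loads-runAlg [] xs i k ⟩
    loads (toList xs) i k                          ≤⟨ bounded (balanced i) k ⟩
    2 * makespan (units n) xs σ                    ∎
    where
    open ≤-Reasoning
    balanced : ∀ i → Balanced (makespan (units n) xs σ) (loads (toList xs) i)
    balanced = balanced-loads (toList xs) (scenarioCount≤ xs σ)
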